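{- Let $G$ be a graph on $n$ vertices with $\mathrm{diam}(G)\le 2$, and let $\overline{G}$ be its complement with adjacency matrix $A^{\overline G}$. For $0\le k\le n$ let $a_k$ be the coefficient of $q^{2k}x^{n-k}$ in $P_{\mathcal{D}_q,G}(x+1)$. Then $\det(xI-A^{\overline G})=\sum_{k=0}^n a_kx^{n-k}$.
   Context: The exponential distance matrix $\mathcal{D}_q^G$ is indexed by $V(G)$ with $(u,v)$-entry $q^{\mathrm{dist}_G(u,v)}$ if $u,v$ lie in the same component and $0$ otherwise, where $q$ is a variable, and $P_{\mathcal{D}_q,G}(x)=\det(xI-\mathcal{D}_q^G)$. -}

module Defs where

open import Data.Nat as ℕ using (ℕ; zero; suc; _∸_)
open import Data.Bool using (Bool; true; false; _∧_; _∨_; not; if_then_else_)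
open import Data.Fin using (Fin; zero; suc; punchIn; toℕ)
open import Data.Fin.Properties using () renaming (_≟_ to _≟ᶠ_)
open import Data.Integer as ℤ using (ℤ)
open import Data.Maybe using (Maybe; just; nothing)
open import Data.List using (List; foldr; map; upTo)
open import Relation.Nullary.Decidable using (⌊_⌋)
open import Relation.Binary.PropositionalEquality using (_≡_)

-- Raw commutative-ring operations (enough to define determinants and
-- polynomial arithmetic; laws are not needed for the statement).

record RawCRing : Set₁ where
  field
    Carrier : Set
    0# 1#   : Carrier
    _+_ _*_ : Carrier → Carrier → Carrier
    -_      : Carrier → Carrier

ℤ-raw : RawCRing
ℤ-raw = record { Carrier = ℤ ; 0# = ℤ.0ℤ ; 1# = ℤ.1ℤ
               ; _+_ = ℤ._+_ ; _*_ = ℤ._*_ ; -_ = ℤ.-_ }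

-- Polynomials R[t] as coefficient sequences ℕ → R (coefficient of t^i).
-- Sums/products of polynomials only ever involve finitely many terms.

module _ (R : RawCRing) where
  open RawCRing R

  sumTo : ℕ → (ℕ → Carrier) → Carrier
  sumTo m f = foldr _+_ 0# (map f (upTo (suc m)))

  polyRaw : RawCRing
  polyRaw = record
    { Carrier = ℕ → Carrier
    ; 0# = λ _ → 0#
    ; 1# = λ { zero → 1# ; (suc _) → 0# }
    ; _+_ = λ f g i → f i + g i
    ; _*_ = λ f g m → sumTo m (λ i → f i * g (m ∸ i))
    ; -_ = λ f i → - f i
    }

  var : ℕ → Carrier
  var (suc zero) = 1#
  var _ = 0#

  const : Carrier → ℕ → Carrier
  const c zero = c
  const c (suc _) = 0#

  monomial : Carrier → ℕ → ℕ → Carrier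
  monomial c m i = if ⌊ i ℕ.≟ m ⌋ then c else 0#

module _ (R : RawCRing) where
  open RawCRing R

  sumFin : (n : ℕ) → (Fin n → Carrier) → Carrier
  sumFin zero f = 0#
  sumFin (suc n) f = f zero + sumFin n (λ i → f (suc i))

  altSumFin : (n : ℕ) → (Fin n → Carrier) → Carrier
  altSumFin zero f = 0#
  altSumFin (suc n) f = f zero + (- altSumFin n (λ i → f (suc i)))

  det : (n : ℕ) → (Fin n → Fin n → Carrier) → Carrier
  det zero M = 1#
  det (suc n) M =
    altSumFin (suc n) λ j →
      M zero j * det n (λ r c → M (suc r) (punchIn j c))

  shiftMat : (n : ℕ) → Carrier → (Fin n → Fin n → Carrier) → Fin n → Fin n → Carrier
  shiftMat n t M u v = (if ⌊ u ≟ᶠ v ⌋ then t else 0#) + (- M u v)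

record Graph (n : ℕ) : Set where
  field
    adj       : Fin n → Fin n → Bool
    adj-sym   : ∀ u v → adj u v ≡ adj v u
    adj-irref : ∀ u → adj u u ≡ false

module _ {n : ℕ} (G : Graph n) where
  open Graph G

  anyFin : (m : ℕ) → (Fin m → Bool) → Bool
  anyFin zero f = false
  anyFin (suc m) f = f zero ∨ anyFin m (λ i → f (suc i))

  reachWithin : ℕ → Fin n → Fin n → Bool
  reachWithin zero u v = ⌊ u ≟ᶠ v ⌋
  reachWithin (suc k) u v =
    reachWithin k u v ∨ anyFin n (λ w → adj u w ∧ reachWithin k w v)

  -- dist_G(u,v): least k (< n) with a walk of length ≤ k; nothing if
  -- u and v lie in different components.
  distFrom : ℕ → ℕ → Fin n → Fin n → Maybe ℕ
  distFrom k zero u v = nothing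
  distFrom k (suc fuel) u v =
    if reachWithin k u v then just k else distFrom (suc k) fuel u v

  dist : Fin n → Fin n → Maybe ℕ
  dist = distFrom 0 n

  DiamAtMost2 : Set
  DiamAtMost2 = ∀ u v → reachWithin 2 u v ≡ true

  complAdj : Fin n → Fin n → ℤ
  complAdj u v =
    if not ⌊ u ≟ᶠ v ⌋ ∧ not (adj u v) then ℤ.1ℤ else ℤ.0ℤ

ℤ[q] : RawCRing
ℤ[q] = polyRaw ℤ-raw

ℤ[q][x] : RawCRing
ℤ[q][x] = polyRaw ℤ[q]

ℤ[x] : RawCRing
ℤ[x] = polyRaw ℤ-raw

qPow : ℕ → RawCRing.Carrier ℤ[q]
qPow d = monomial ℤ-raw ℤ.1ℤ d

module _ {n : ℕ} (G : Graph n) where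

  expDistMat : Fin n → Fin n → RawCRing.Carrier ℤ[q]
  expDistMat u v with dist G u v
  ... | just d  = qPow d
  ... | nothing = RawCRing.0# ℤ[q]

  PDq-at : RawCRing.Carrier ℤ[q][x] → RawCRing.Carrier ℤ[q][x]
  PDq-at t = det ℤ[q][x] n
    (shiftMat ℤ[q][x] n t (λ u v → const ℤ[q] (expDistMat u v)))

  PDq-shifted : RawCRing.Carrier ℤ[q][x]
  PDq-shifted = PDq-at (RawCRing._+_ ℤ[q][x] (var ℤ[q]) (RawCRing.1# ℤ[q][x]))

  coeffA : ℕ → ℤ
  coeffA k = PDq-shifted (n ∸ k) (2 ℕ.* k)

  charPolyCompl : RawCRing.Carrier ℤ[x]
  charPolyCompl = det ℤ[x] n
    (shiftMat ℤ[x] n (var ℤ-raw) (λ u v → const ℤ-raw (complAdj G u v)))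

  rhsPoly : RawCRing.Carrier ℤ[x]
  rhsPoly = sumTo ℤ[x] n (λ k → monomial ℤ-raw (coeffA k) (n ∸ k))

{-# OPTIONS --safe #-}
-- Give x weight 2 and q weight 1. When diam G ≤ 2 every entry of (x + 1)I − D_q
-- has weight at most 2: the diagonal is x + 1 − 1 = x, an edge gives −q and a
-- non-edge −q². Keeping only the weight-2 part and putting q = 1 turns these into
-- x, 0 and −1, the entries of xI − A^Ḡ. Taking top-weight parts is multiplicative,
-- so the weight-2n part of P_{D_q,G}(x + 1) is det(xI − A^Ḡ), and its coefficient
-- of x^{n−k} sits at q^{2k}, which is a_k.
module Submission where

open import Defs
open import Data.Bool using (Bool; true; false; _∧_; _∨_; if_then_else_)
open import Data.Bool.Properties using (∧-identityʳ; ∧-zeroʳ; ∨-identityʳ; ∨-zeroʳ)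
open import Data.Fin using (Fin; zero; suc; punchIn; punchOut)
open import Data.Fin.Properties using (punchOut-injective) renaming (_≟_ to _≟ᶠ_)
open import Data.Integer as ℤ using (ℤ; 0ℤ; 1ℤ)
import Data.Integer.Properties as ℤ
open import Data.List using (foldr; map; applyUpTo)
open import Data.Maybe using (just)
open import Data.Nat using (ℕ; zero; suc; _+_; _*_; _∸_; _≤_; _<_; z≤n; s≤s; z<s; s<s; s≤s⁻¹; _≟_; _≤?_; _<?_)
open import Data.Nat.Properties
open import Data.Nat.Tactic.RingSolver using (solve-∀)
open import Data.Product using (∃-syntax; _×_; _,_)
open import Data.Sum using (_⊎_; inj₁; inj₂)
open import Function using (id; _∘_)
open import Relation.Binary.Definitions using (tri<; tri≈; tri>)
open import Relation.Binary.PropositionalEquality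
open import Relation.Nullary using (Dec; ¬_; yes; no; contradiction)
open import Relation.Nullary.Decidable using (⌊_⌋; ⌊⌋-map′; isYes≗does; dec-true; dec-false)

module _ (R : RawCRing) where
  open RawCRing R using (Carrier; 0#) renaming (_+_ to _⊕_)

  sumBelow : ℕ → (ℕ → Carrier) → Carrier
  sumBelow zero    h = 0#
  sumBelow (suc k) h = h 0 ⊕ sumBelow k (h ∘ suc)

  sumBelow-cong : ∀ k {h h′ : ℕ → Carrier} → (∀ i → i < k → h i ≡ h′ i) →
                  sumBelow k h ≡ sumBelow k h′
  sumBelow-cong zero    eq = refl
  sumBelow-cong (suc k) eq = cong₂ _⊕_ (eq 0 z<s) (sumBelow-cong k (λ i i<k → eq (suc i) (s<s i<k)))

  sumTo≡sumBelow : ∀ m h → sumTo R m h ≡ sumBelow (suc m) h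
  sumTo≡sumBelow m h = foldr-applyUpTo (suc m) id
    where
    foldr-applyUpTo : ∀ k g → foldr _⊕_ 0# (map h (applyUpTo g k)) ≡ sumBelow k (h ∘ g)
    foldr-applyUpTo zero    g = refl
    foldr-applyUpTo (suc k) g = cong (h (g 0) ⊕_) (foldr-applyUpTo k (g ∘ suc))

module _ (R : RawCRing) where
  open RawCRing R using (Carrier) renaming (_+_ to _⊕_)

  sumBelow-coeff : ∀ k (F : ℕ → ℕ → Carrier) a →
                   sumBelow (polyRaw R) k F a ≡ sumBelow R k (λ i → F i a)
  sumBelow-coeff zero    F a = refl
  sumBelow-coeff (suc k) F a = cong (F 0 a ⊕_) (sumBelow-coeff k (F ∘ suc) a)

  sumTo-coeff : ∀ m (F : ℕ → ℕ → Carrier) a →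
                sumTo (polyRaw R) m F a ≡ sumBelow R (suc m) (λ i → F i a)
  sumTo-coeff m F a =
    trans (cong (λ p → p a) (sumTo≡sumBelow (polyRaw R) m F)) (sumBelow-coeff (suc m) F a)

sumBelow-zero : ∀ k {h : ℕ → ℤ} → (∀ i → i < k → h i ≡ 0ℤ) → sumBelow ℤ-raw k h ≡ 0ℤ
sumBelow-zero zero    h≡0 = refl
sumBelow-zero (suc k) h≡0 =
  cong₂ ℤ._+_ (h≡0 0 z<s) (sumBelow-zero k (λ i i<k → h≡0 (suc i) (s<s i<k)))

sumBelow-delta : ∀ k {h : ℕ → ℤ} {i₀} → i₀ < k → (∀ i → i < k → i ≢ i₀ → h i ≡ 0ℤ) →
                 sumBelow ℤ-raw k h ≡ h i₀
sumBelow-delta (suc k) {h} {zero} _ off = begin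
  h 0 ℤ.+ sumBelow ℤ-raw k (h ∘ suc)
    ≡⟨ cong (ℤ._+_ (h 0)) (sumBelow-zero k (λ i i<k → off (suc i) (s<s i<k) (λ ()))) ⟩
  h 0 ℤ.+ 0ℤ
    ≡⟨ ℤ.+-identityʳ (h 0) ⟩
  h 0 ∎
  where open ≡-Reasoning
sumBelow-delta (suc k) {h} {suc i₀} (s<s i₀<k) off = begin
  h 0 ℤ.+ sumBelow ℤ-raw k (h ∘ suc)
    ≡⟨ cong (ℤ._+ sumBelow ℤ-raw k (h ∘ suc)) (off 0 z<s (λ ())) ⟩
  0ℤ ℤ.+ sumBelow ℤ-raw k (h ∘ suc)
    ≡⟨ ℤ.+-identityˡ _ ⟩
  sumBelow ℤ-raw k (h ∘ suc)
    ≡⟨ sumBelow-delta k i₀<k (λ i i<k i≢i₀ → off (suc i) (s<s i<k) (i≢i₀ ∘ suc-injective)) ⟩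
  h (suc i₀) ∎
  where open ≡-Reasoning

*-vanishesˡ : ∀ {x} y → x ≡ 0ℤ → x ℤ.* y ≡ 0ℤ
*-vanishesˡ y refl = ℤ.*-zeroˡ y

*-vanishesʳ : ∀ x {y} → y ≡ 0ℤ → x ℤ.* y ≡ 0ℤ
*-vanishesʳ x refl = ℤ.*-zeroʳ x

convolution-top : ∀ r s {p q : ℕ → ℤ} → (∀ l → r < l → p l ≡ 0ℤ) → (∀ m → s < m → q m ≡ 0ℤ) →
                  sumBelow ℤ-raw (suc (r + s)) (λ l → p l ℤ.* q (r + s ∸ l)) ≡ p r ℤ.* q s
convolution-top r s {p} {q} p-support q-support =
  trans (sumBelow-delta (suc (r + s)) (s≤s (m≤m+n r s)) off-diagonal)
        (cong (λ m → p r ℤ.* q m) (m+n∸m≡n r s))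
  where
  off-diagonal : ∀ l → l < suc (r + s) → l ≢ r → p l ℤ.* q (r + s ∸ l) ≡ 0ℤ
  off-diagonal l _ l≢r with <-cmp l r
  ... | tri< l<r _ _ = *-vanishesʳ (p l) (q-support (r + s ∸ l)
                         (subst (s <_) (sym (+-∸-comm s (<⇒≤ l<r))) (m<n+m s (m<n⇒0<n∸m l<r))))
  ... | tri≈ _ l≡r _ = contradiction l≡r l≢r
  ... | tri> _ _ r<l = *-vanishesˡ (q (r + s ∸ l)) (p-support l r<l)

Poly₁ : Set
Poly₁ = RawCRing.Carrier ℤ[x]

Poly₂ : Set
Poly₂ = RawCRing.Carrier ℤ[q][x]

_*₁_ : Poly₁ → Poly₁ → Poly₁
_*₁_ = RawCRing._*_ ℤ[x]

_*₂_ : Poly₂ → Poly₂ → Poly₂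
_*₂_ = RawCRing._*_ ℤ[q][x]

*₁-coeff : ∀ s t b → (s *₁ t) b ≡ sumBelow ℤ-raw (suc b) (λ i → s i ℤ.* t (b ∸ i))
*₁-coeff s t b = sumTo≡sumBelow ℤ-raw b (λ i → s i ℤ.* t (b ∸ i))

*₁-cong : ∀ {s s′ t t′ : Poly₁} → (∀ i → s i ≡ s′ i) → (∀ i → t i ≡ t′ i) →
          ∀ b → (s *₁ t) b ≡ (s′ *₁ t′) b
*₁-cong {s} {s′} {t} {t′} s≡s′ t≡t′ b = begin
  (s *₁ t) b                                              ≡⟨ *₁-coeff s t b ⟩
  sumBelow ℤ-raw (suc b) (λ i → s i ℤ.* t (b ∸ i))
    ≡⟨ sumBelow-cong ℤ-raw (suc b) (λ i _ → cong₂ ℤ._*_ (s≡s′ i) (t≡t′ (b ∸ i))) ⟩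
  sumBelow ℤ-raw (suc b) (λ i → s′ i ℤ.* t′ (b ∸ i))      ≡⟨ sym (*₁-coeff s′ t′ b) ⟩
  (s′ *₁ t′) b                                            ∎
  where open ≡-Reasoning

*₂-coeff : ∀ f g b a → (f *₂ g) b a ≡
  sumBelow ℤ-raw (suc b) (λ i → sumBelow ℤ-raw (suc a) (λ l → f i l ℤ.* g (b ∸ i) (a ∸ l)))
*₂-coeff f g b a = begin
  (f *₂ g) b a
    ≡⟨ sumTo-coeff ℤ-raw b (λ i → RawCRing._*_ ℤ[q] (f i) (g (b ∸ i))) a ⟩
  sumBelow ℤ-raw (suc b) (λ i → RawCRing._*_ ℤ[q] (f i) (g (b ∸ i)) a)
    ≡⟨ sumBelow-cong ℤ-raw (suc b)
         (λ i _ → sumTo≡sumBelow ℤ-raw a (λ l → f i l ℤ.* g (b ∸ i) (a ∸ l))) ⟩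
  sumBelow ℤ-raw (suc b) (λ i → sumBelow ℤ-raw (suc a) (λ l → f i l ℤ.* g (b ∸ i) (a ∸ l))) ∎
  where open ≡-Reasoning

-- f b a is the coefficient of xᵇqᵃ; x gets weight 2 and q weight 1.
WeightAtMost : ℕ → Poly₂ → Set
WeightAtMost d f = ∀ b a → d < 2 * b + a → f b a ≡ 0ℤ

-- The weight-d part of f at q = 1. When 2b > d the truncated subtraction
-- reads off f b 0, which vanishes under WeightAtMost d f.
topPart : ℕ → Poly₂ → Poly₁
topPart d f b = f b (d ∸ 2 * b)

weight-row-vanishes : ∀ {d f b} → WeightAtMost d f → d < 2 * b → ∀ a → f b a ≡ 0ℤ
weight-row-vanishes {b = b} w d<2b a = w b a (≤-trans d<2b (m≤m+n (2 * b) a))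

+-<-cases : ∀ {d e s t} → d + e < s + t → d < s ⊎ e < t
+-<-cases {d} {e} {s} {t} lt with d <? s | e <? t
... | yes d<s | _       = inj₁ d<s
... | no  _   | yes e<t = inj₂ e<t
... | no  d≮s | no  e≮t = contradiction (+-mono-≤ (≮⇒≥ d≮s) (≮⇒≥ e≮t)) (<⇒≱ lt)

weight-interchange : ∀ i c l m → 2 * (i + c) + (l + m) ≡ (2 * i + l) + (2 * c + m)
weight-interchange = solve-∀

+-∸-interchange : ∀ {a b x y} → x ≤ a → y ≤ b → (a + b) ∸ (x + y) ≡ (a ∸ x) + (b ∸ y)
+-∸-interchange {a} {b} {x} {y} x≤a y≤b = begin
  (a + b) ∸ (x + y)   ≡⟨ sym (∸-+-assoc (a + b) x y) ⟩
  (a + b) ∸ x ∸ y     ≡⟨ cong (_∸ y) (+-∸-comm b x≤a) ⟩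
  (a ∸ x) + b ∸ y     ≡⟨ +-∸-assoc (a ∸ x) y≤b ⟩
  (a ∸ x) + (b ∸ y)   ∎
  where open ≡-Reasoning

module _ {d e : ℕ} {f g : Poly₂} (wf : WeightAtMost d f) (wg : WeightAtMost e g) where

  weight-* : WeightAtMost (d + e) (f *₂ g)
  weight-* b a lt = trans (*₂-coeff f g b a)
    (sumBelow-zero (suc b) λ i i≤b → sumBelow-zero (suc a) λ l l≤a →
      term-vanishes i (b ∸ i) l (a ∸ l)
        (subst₂ (λ b′ a′ → d + e < 2 * b′ + a′)
          (sym (m+[n∸m]≡n (s≤s⁻¹ i≤b))) (sym (m+[n∸m]≡n (s≤s⁻¹ l≤a))) lt))
    where
    term-vanishes : ∀ i c l m → d + e < 2 * (i + c) + (l + m) → f i l ℤ.* g c m ≡ 0ℤ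
    term-vanishes i c l m lt with +-<-cases (subst (d + e <_) (weight-interchange i c l m) lt)
    ... | inj₁ d<2i+l = *-vanishesˡ (g c m) (wf i l d<2i+l)
    ... | inj₂ e<2c+m = *-vanishesʳ (f i l) (wg c m e<2c+m)

  -- Only the terms of weight exactly d in f and e in g contribute to weight d + e.
  topPart-* : ∀ b → topPart (d + e) (f *₂ g) b ≡ (topPart d f *₁ topPart e g) b
  topPart-* b = begin
    topPart (d + e) (f *₂ g) b
      ≡⟨ *₂-coeff f g b (d + e ∸ 2 * b) ⟩
    sumBelow ℤ-raw (suc b) (λ i → inner i)
      ≡⟨ sumBelow-cong ℤ-raw (suc b) (λ i i≤b → inner-top (s≤s⁻¹ i≤b)) ⟩
    sumBelow ℤ-raw (suc b) (λ i → topPart d f i ℤ.* topPart e g (b ∸ i))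
      ≡⟨ sym (*₁-coeff (topPart d f) (topPart e g) b) ⟩
    (topPart d f *₁ topPart e g) b ∎
    where
    open ≡-Reasoning
    A : ℕ
    A = d + e ∸ 2 * b

    inner : ℕ → ℤ
    inner i = sumBelow ℤ-raw (suc A) (λ l → f i l ℤ.* g (b ∸ i) (A ∸ l))

    inner-top : ∀ {i} → i ≤ b → inner i ≡ topPart d f i ℤ.* topPart e g (b ∸ i)
    inner-top {i} i≤b with 2 * i ≤? d | 2 * (b ∸ i) ≤? e
    ... | no 2i≰d | _ =
      trans (sumBelow-zero (suc A) (λ l _ → *-vanishesˡ (g (b ∸ i) (A ∸ l)) (f-row l)))
            (sym (*-vanishesˡ (topPart e g (b ∸ i)) (f-row (d ∸ 2 * i))))
      where f-row = weight-row-vanishes {b = i} wf (≰⇒> 2i≰d)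
    ... | yes _ | no 2c≰e =
      trans (sumBelow-zero (suc A) (λ l _ → *-vanishesʳ (f i l) (g-row (A ∸ l))))
            (sym (*-vanishesʳ (topPart d f i) (g-row (e ∸ 2 * (b ∸ i)))))
      where g-row = weight-row-vanishes {b = b ∸ i} wg (≰⇒> 2c≰e)
    ... | yes 2i≤d | yes 2c≤e = begin
      inner i
        ≡⟨ cong (λ A′ → sumBelow ℤ-raw (suc A′) (λ l → f i l ℤ.* g c (A′ ∸ l))) A≡r+s ⟩
      sumBelow ℤ-raw (suc (r + s)) (λ l → f i l ℤ.* g c (r + s ∸ l))
        ≡⟨ convolution-top r s (λ l r<l → wf i l (beyond 2i≤d r<l))
                               (λ m s<m → wg c m (beyond 2c≤e s<m)) ⟩
      f i r ℤ.* g c s ∎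
      where
      c = b ∸ i
      r = d ∸ 2 * i
      s = e ∸ 2 * c
      beyond : ∀ {w k t} → w ≤ k → k ∸ w < t → k < w + t
      beyond {w} w≤k lt = subst (_< w + _) (m+[n∸m]≡n w≤k) (+-monoʳ-< w lt)
      A≡r+s : A ≡ r + s
      A≡r+s = begin
        d + e ∸ 2 * b            ≡⟨ cong (λ b′ → d + e ∸ 2 * b′) (sym (m+[n∸m]≡n i≤b)) ⟩
        d + e ∸ 2 * (i + c)      ≡⟨ cong (d + e ∸_) (*-distribˡ-+ 2 i c) ⟩
        d + e ∸ (2 * i + 2 * c)  ≡⟨ +-∸-interchange 2i≤d 2c≤e ⟩
        r + s                    ∎

minor : ∀ {A : Set} {n} → Fin (suc n) → (Fin (suc n) → Fin (suc n) → A) → Fin n → Fin n → A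
minor j M r c = M (suc r) (punchIn j c)

weight-1 : WeightAtMost 0 (RawCRing.1# ℤ[q][x])
weight-1 zero    (suc a) _ = refl
weight-1 (suc b) a       _ = refl

topPart-1 : ∀ b → topPart 0 (RawCRing.1# ℤ[q][x]) b ≡ RawCRing.1# ℤ[x] b
topPart-1 zero    = refl
topPart-1 (suc b) = refl

weight-altSum : ∀ {d} n {F : Fin n → Poly₂} → (∀ j → WeightAtMost d (F j)) →
                WeightAtMost d (altSumFin ℤ[q][x] n F)
weight-altSum zero    w b a lt = refl
weight-altSum (suc n) w b a lt =
  cong₂ (λ x y → x ℤ.+ ℤ.- y) (w zero b a lt) (weight-altSum n (w ∘ suc) b a lt)

topPart-altSum : ∀ {d} n {F : Fin n → Poly₂} {H : Fin n → Poly₁} →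
                 (∀ j b → topPart d (F j) b ≡ H j b) →
                 ∀ b → topPart d (altSumFin ℤ[q][x] n F) b ≡ altSumFin ℤ[x] n H b
topPart-altSum zero    eq b = refl
topPart-altSum (suc n) eq b =
  cong₂ (λ x y → x ℤ.+ ℤ.- y) (eq zero b) (topPart-altSum n (eq ∘ suc) b)

module _ {d : ℕ} where

  weight-det : ∀ n {M : Fin n → Fin n → Poly₂} → (∀ u v → WeightAtMost d (M u v)) →
               WeightAtMost (n * d) (det ℤ[q][x] n M)
  weight-det zero    w = weight-1
  weight-det (suc n) {M} w = weight-altSum (suc n) λ j →
    weight-* (w zero j) (weight-det n {minor j M} (λ u v → w (suc u) (punchIn j v)))

  topPart-det : ∀ n {M : Fin n → Fin n → Poly₂} {T : Fin n → Fin n → Poly₁} →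
                (∀ u v → WeightAtMost d (M u v)) → (∀ u v b → T u v b ≡ topPart d (M u v) b) →
                ∀ b → topPart (n * d) (det ℤ[q][x] n M) b ≡ det ℤ[x] n T b
  topPart-det zero    w eq = topPart-1
  topPart-det (suc n) {M} {T} w eq =
    topPart-altSum (suc n) {F = λ j → M zero j *₂ det ℤ[q][x] n (minor j M)}
                           {H = λ j → T zero j *₁ det ℤ[x] n (minor j T)} λ j b →
      trans (topPart-* (w zero j) (weight-det n {minor j M} (w-minor j)) b)
            (*₁-cong (sym ∘ eq zero j)
                     (topPart-det n {minor j M} {minor j T} (w-minor j) (eq-minor j)) b)
    where
    w-minor : ∀ j u v → WeightAtMost d (minor j M u v)
    w-minor j u v = w (suc u) (punchIn j v)
    eq-minor : ∀ j u v b → minor j T u v b ≡ topPart d (minor j M u v) b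
    eq-minor j u v = eq (suc u) (punchIn j v)

x+1 : Poly₂
x+1 = RawCRing._+_ ℤ[q][x] (var ℤ[q]) (RawCRing.1# ℤ[q][x])

distEntry : Bool → RawCRing.Carrier ℤ[q] → Poly₂
distEntry δ e = (if δ then x+1 else 0#) ⊕ (⊖ const ℤ[q] e)
  where open RawCRing ℤ[q][x] using (0#) renaming (_+_ to _⊕_; -_ to ⊖_)

complEntry : Bool → ℤ → Poly₁
complEntry δ c = (if δ then var ℤ-raw else 0#) ⊕ (⊖ const ℤ-raw c)
  where open RawCRing ℤ[x] using (0#) renaming (_+_ to _⊕_; -_ to ⊖_)

data EntryKind : Bool → RawCRing.Carrier ℤ[q] → ℤ → Set where
  diagonal    : EntryKind true  (qPow 0) 0ℤ
  adjacent    : EntryKind false (qPow 1) 0ℤ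
  nonAdjacent : EntryKind false (qPow 2) 1ℤ

weight-distEntry : ∀ {δ e c} → EntryKind δ e c → WeightAtMost 2 (distEntry δ e)
weight-distEntry diagonal    zero          (suc (suc (suc a))) _ = refl
weight-distEntry diagonal    (suc zero)    (suc a)             _ = refl
weight-distEntry diagonal    (suc (suc b)) a                   _ = refl
weight-distEntry adjacent    zero          (suc (suc (suc a))) _ = refl
weight-distEntry adjacent    (suc b)       a                   _ = refl
weight-distEntry nonAdjacent zero          (suc (suc (suc a))) _ = refl
weight-distEntry nonAdjacent (suc b)       a                   _ = refl
weight-distEntry _           zero          zero                ()
weight-distEntry _           zero          (suc zero)          (s≤s ())
weight-distEntry _           zero          (suc (suc zero))    (s≤s (s≤s ()))
weight-distEntry diagonal    (suc zero)    zero                (s≤s (s≤s ()))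

topPart-distEntry : ∀ {δ e c} → EntryKind δ e c →
                    ∀ b → complEntry δ c b ≡ topPart 2 (distEntry δ e) b
topPart-distEntry diagonal    zero          = refl
topPart-distEntry diagonal    (suc zero)    = refl
topPart-distEntry diagonal    (suc (suc b)) = refl
topPart-distEntry adjacent    zero          = refl
topPart-distEntry adjacent    (suc b)       = refl
topPart-distEntry nonAdjacent zero          = refl
topPart-distEntry nonAdjacent (suc b)       = refl

⌊⌋-true : ∀ {A : Set} (a? : Dec A) → A → ⌊ a? ⌋ ≡ true
⌊⌋-true a? a = trans (isYes≗does a?) (dec-true a? a)

⌊⌋-false : ∀ {A : Set} (a? : Dec A) → ¬ A → ⌊ a? ⌋ ≡ false
⌊⌋-false a? ¬a = trans (isYes≗does a?) (dec-false a? ¬a)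

∧-true⁻¹ : ∀ {x y} → x ∧ y ≡ true → x ≡ true × y ≡ true
∧-true⁻¹ {true} {true} refl = refl , refl

Fin-nonempty : ∀ {n} → Fin n → 0 < n
Fin-nonempty {suc n} _ = z<s

distinct⇒1<n : ∀ {n} {u v : Fin n} → u ≢ v → 1 < n
distinct⇒1<n {suc n} u≢v = s<s (Fin-nonempty (punchOut u≢v))

distinct₃⇒2<n : ∀ {n} {u v w : Fin n} → u ≢ v → u ≢ w → v ≢ w → 2 < n
distinct₃⇒2<n {suc n} u≢v u≢w v≢w = s<s (distinct⇒1<n (v≢w ∘ punchOut-injective u≢v u≢w))

module _ {n : ℕ} (G : Graph n) where
  open Graph G

  anyFin-cong : ∀ m {p p′ : Fin m → Bool} → (∀ i → p i ≡ p′ i) → anyFin G m p ≡ anyFin G m p′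
  anyFin-cong zero    eq = refl
  anyFin-cong (suc m) eq = cong₂ _∨_ (eq zero) (anyFin-cong m (eq ∘ suc))

  anyFin-false : ∀ m {p : Fin m → Bool} → (∀ i → p i ≡ false) → anyFin G m p ≡ false
  anyFin-false zero    eq = refl
  anyFin-false (suc m) eq = cong₂ _∨_ (eq zero) (anyFin-false m (eq ∘ suc))

  anyFin-true⁻¹ : ∀ m {p : Fin m → Bool} → anyFin G m p ≡ true → ∃[ w ] p w ≡ true
  anyFin-true⁻¹ (suc m) {p} any with p zero in p0
  ... | true  = zero , p0
  ... | false with anyFin-true⁻¹ m any
  ...   | w , pw = suc w , pw

  anyFin-select : ∀ m (p : Fin m → Bool) v → anyFin G m (λ w → p w ∧ ⌊ w ≟ᶠ v ⌋) ≡ p v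
  anyFin-select (suc m) p zero =
    trans (cong₂ _∨_ (∧-identityʳ (p zero)) (anyFin-false m (λ i → ∧-zeroʳ (p (suc i)))))
          (∨-identityʳ (p zero))
  anyFin-select (suc m) p (suc v) =
    cong₂ _∨_ (∧-zeroʳ (p zero))
      (trans (anyFin-cong m (λ i → cong (p (suc i) ∧_) (⌊⌋-map′ _ _ (i ≟ᶠ v))))
             (anyFin-select m (p ∘ suc) v))

  reachWithin-1 : ∀ u v → reachWithin G 1 u v ≡ ⌊ u ≟ᶠ v ⌋ ∨ adj u v
  reachWithin-1 u v = cong (⌊ u ≟ᶠ v ⌋ ∨_) (anyFin-select n (adj u) v)

  reachWithin-1-false : ∀ {u v} → u ≢ v → adj u v ≡ false → reachWithin G 1 u v ≡ false
  reachWithin-1-false {u} {v} u≢v ¬uv =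
    trans (reachWithin-1 u v) (cong₂ _∨_ (⌊⌋-false (u ≟ᶠ v) u≢v) ¬uv)

  adj⇒≢ : ∀ {u v} → adj u v ≡ true → u ≢ v
  adj⇒≢ {u} uv refl with () ← trans (sym uv) (adj-irref u)

  distFrom-firstHit : ∀ {u v s k} fuel → s ≤ k → k < s + fuel →
                      (∀ i → s ≤ i → i < k → reachWithin G i u v ≡ false) →
                      reachWithin G k u v ≡ true → distFrom G s fuel u v ≡ just k
  distFrom-firstHit {s = s} zero s≤k k<s+0 _ _ =
    contradiction (subst (_ <_) (+-identityʳ s) k<s+0) (≤⇒≯ s≤k)
  distFrom-firstHit {u} {v} {s} {k} (suc fuel) s≤k k<s+fuel miss hit with s ≟ k
  ... | yes refl = cong (λ r → if r then just s else distFrom G (suc s) fuel u v) hit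
  ... | no s≢k =
    trans (cong (λ r → if r then just s else distFrom G (suc s) fuel u v) (miss s ≤-refl s<k))
          (distFrom-firstHit fuel s<k (subst (k <_) (+-suc s fuel) k<s+fuel)
                             (λ i s<i → miss i (<⇒≤ s<i)) hit)
    where s<k = ≤∧≢⇒< s≤k s≢k

  dist-firstHit : ∀ {u v} k → k < n → (∀ i → i < k → reachWithin G i u v ≡ false) →
                  reachWithin G k u v ≡ true → dist G u v ≡ just k
  dist-firstHit k k<n miss = distFrom-firstHit n z≤n k<n (λ i _ → miss i)

  dist-diagonal : ∀ u → dist G u u ≡ just 0
  dist-diagonal u = dist-firstHit 0 (Fin-nonempty u) (λ _ ()) (⌊⌋-true (u ≟ᶠ u) refl)

  dist-adjacent : ∀ {u v} → adj u v ≡ true → dist G u v ≡ just 1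
  dist-adjacent {u} {v} uv = dist-firstHit 1 (distinct⇒1<n (adj⇒≢ uv))
    (λ { zero _ → ⌊⌋-false (u ≟ᶠ v) (adj⇒≢ uv) ; (suc _) (s<s ()) })
    (trans (reachWithin-1 u v) (trans (cong (⌊ u ≟ᶠ v ⌋ ∨_) uv) (∨-zeroʳ _)))

  commonNeighbour : DiamAtMost2 G → ∀ {u v} → reachWithin G 1 u v ≡ false →
                    ∃[ w ] adj u w ≡ true × reachWithin G 1 w v ≡ true
  commonNeighbour diam {u} {v} far
    using viaNeighbour ← anyFin G n (λ w → adj u w ∧ reachWithin G 1 w v)
    with w , uw∧wv ← anyFin-true⁻¹ n (trans (cong (_∨ viaNeighbour) (sym far)) (diam u v))
    = w , ∧-true⁻¹ uw∧wv

  dist-nonAdjacent : DiamAtMost2 G → ∀ {u v} → u ≢ v → adj u v ≡ false → dist G u v ≡ just 2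
  dist-nonAdjacent diam {u} {v} u≢v ¬uv
    with w , uw , _ ← commonNeighbour diam (reachWithin-1-false u≢v ¬uv)
    = dist-firstHit 2 (distinct₃⇒2<n u≢v (adj⇒≢ uw) v≢w)
        (λ { zero          _                → ⌊⌋-false (u ≟ᶠ v) u≢v
           ; (suc zero)    _                → reachWithin-1-false u≢v ¬uv
           ; (suc (suc _)) (s<s (s<s ())) })
        (diam u v)
    where
    v≢w : v ≢ w
    v≢w refl with () ← trans (sym uw) ¬uv

  expDistMat-dist : ∀ {u v d} → dist G u v ≡ just d → expDistMat G u v ≡ qPow d
  expDistMat-dist {u} {v} eq with dist G u v | eq
  ... | _ | refl = refl

  entryKind : DiamAtMost2 G → ∀ u v → EntryKind ⌊ u ≟ᶠ v ⌋ (expDistMat G u v) (complAdj G u v)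
  entryKind diam u v with u ≟ᶠ v
  ... | yes refl rewrite expDistMat-dist (dist-diagonal u) = diagonal
  ... | no u≢v with adj u v in uv
  ...   | true  rewrite expDistMat-dist (dist-adjacent uv) = adjacent
  ...   | false rewrite expDistMat-dist (dist-nonAdjacent diam u≢v uv) = nonAdjacent

  weight-PDq-shifted : DiamAtMost2 G → WeightAtMost (n * 2) (PDq-shifted G)
  weight-PDq-shifted diam = weight-det n (λ u v → weight-distEntry (entryKind diam u v))

  topPart-PDq-shifted : DiamAtMost2 G → ∀ b → topPart (n * 2) (PDq-shifted G) b ≡ charPolyCompl G b
  topPart-PDq-shifted diam = topPart-det n (λ u v → weight-distEntry (entryKind diam u v))
                                           (λ u v → topPart-distEntry (entryKind diam u v))

module _ (n : ℕ) (c : ℕ → ℤ) where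

  reversedPoly : Poly₁
  reversedPoly = sumTo ℤ[x] n (λ k → monomial ℤ-raw (c k) (n ∸ k))

  reversedPoly-coeff : ∀ {j} → j ≤ n → reversedPoly j ≡ c (n ∸ j)
  reversedPoly-coeff {j} j≤n = begin
    reversedPoly j
      ≡⟨ sumTo-coeff ℤ-raw n (λ k → monomial ℤ-raw (c k) (n ∸ k)) j ⟩
    sumBelow ℤ-raw (suc n) (λ k → monomial ℤ-raw (c k) (n ∸ k) j)
      ≡⟨ sumBelow-delta (suc n) (s≤s (m∸n≤m n j)) off-diagonal ⟩
    monomial ℤ-raw (c (n ∸ j)) (n ∸ (n ∸ j)) j
      ≡⟨ cong (if_then c (n ∸ j) else 0ℤ) (⌊⌋-true (j ≟ n ∸ (n ∸ j)) (sym (m∸[m∸n]≡n j≤n))) ⟩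
    c (n ∸ j) ∎
    where
    open ≡-Reasoning
    off-diagonal : ∀ k → k < suc n → k ≢ n ∸ j → monomial ℤ-raw (c k) (n ∸ k) j ≡ 0ℤ
    off-diagonal k k≤n k≢n∸j = cong (if_then c k else 0ℤ) (⌊⌋-false (j ≟ n ∸ k)
      λ j≡n∸k → k≢n∸j (trans (sym (m∸[m∸n]≡n (s≤s⁻¹ k≤n))) (cong (n ∸_) (sym j≡n∸k))))

  reversedPoly-vanishes : ∀ {j} → n < j → reversedPoly j ≡ 0ℤ
  reversedPoly-vanishes {j} n<j =
    trans (sumTo-coeff ℤ-raw n (λ k → monomial ℤ-raw (c k) (n ∸ k)) j)
          (sumBelow-zero (suc n) λ k _ → cong (if_then c k else 0ℤ) (⌊⌋-false (j ≟ n ∸ k)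
            λ j≡n∸k → <⇒≱ n<j (subst (_≤ n) (sym j≡n∸k) (m∸n≤m n k))))

mainTheorem6 : (n : ℕ) (G : Graph n) → DiamAtMost2 G →
    ∀ (j : ℕ) → charPolyCompl G j ≡ rhsPoly G j
mainTheorem6 n G diam j with j ≤? n
... | yes j≤n = begin
  charPolyCompl G j                  ≡⟨ sym (topPart-PDq-shifted G diam j) ⟩
  PDq-shifted G j (n * 2 ∸ 2 * j)    ≡⟨ cong₂ (PDq-shifted G) (sym (m∸[m∸n]≡n j≤n)) weight-eq ⟩
  coeffA G (n ∸ j)                   ≡⟨ sym (reversedPoly-coeff n (coeffA G) j≤n) ⟩
  rhsPoly G j                        ∎
  where
  open ≡-Reasoning
  weight-eq : n * 2 ∸ 2 * j ≡ 2 * (n ∸ j)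
  weight-eq = trans (cong (_∸ 2 * j) (*-comm n 2)) (sym (*-distribˡ-∸ 2 n j))
... | no j≰n = begin
  charPolyCompl G j                  ≡⟨ sym (topPart-PDq-shifted G diam j) ⟩
  PDq-shifted G j (n * 2 ∸ 2 * j)    ≡⟨ weight-row-vanishes (weight-PDq-shifted G diam) n*2<2*j _ ⟩
  0ℤ                                 ≡⟨ sym (reversedPoly-vanishes n (coeffA G) (≰⇒> j≰n)) ⟩
  rhsPoly G j                        ∎
  where
  open ≡-Reasoning
  n*2<2*j : n * 2 < 2 * j
  n*2<2*j = subst (_< 2 * j) (*-comm 2 n) (*-monoʳ-< 2 (≰⇒> j≰n))
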